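{- Consider the monotone sub-balancing formula of height $h$ on variables $x_0,\dots,x_{2^h-1}$. Any assignment $a_0,\dots,a_{2^h-1}\in\{0,1\}$ for which there exist $0<k\le h$ and $0\le i<2^{h-k}$ such that the number of $1$ values among $a_{i2^k},\dots,a_{(i+1)2^k-1}$ is more than $2^{k-1}$ and less than $2^k$ is not accepted by the formula.
   Context: Alphabet $\Sigma=\{0,F_0,P,F_1,1\}$, ordered in this order. The monotone balancing gate takes two inputs from $\Sigma$ and outputs: $0$ on $(0,0)$; $1$ on $(1,1)$; $P$ on $(1,0)$, $(0,1)$, $(P,P)$; $F_0$ on $(0,P)$, $(P,0)$, $(P,F_0)$, $(F_0,P)$, $(F_0,0)$, $(0,F_0)$, $(F_0,F_0)$; $F_1$ on $(1,P)$, $(P,1)$, $(F_0,1)$, $(1,F_0)$, and on every pair containing $F_1$. The monotone sub-balancing formula of height $h$ is the full balanced binary tree of height $h$ whose leaves are $x_0,\dots,x_{2^h-1}$ in left-to-right order and whose internal gates are all monotone balancing gates; an assignment is accepted if and only if the value at the root is neither $F_1$ nor $1$. -}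

module Defs where

open import Data.Nat using (ℕ; zero; suc; _+_; _*_; _^_; _<_; _<?_)
open import Data.Fin using (Fin; fromℕ<)
open import Data.Bool using (Bool; true; false)
open import Relation.Nullary using (yes; no)
open import Data.Empty using (⊥)
open import Data.Unit using (⊤)

data Σ : Set where
  c0 F0 P F1 c1 : Σ

gate : Σ → Σ → Σ
gate F1 _  = F1
gate _  F1 = F1
gate c0 c0 = c0
gate c1 c1 = c1
gate c1 c0 = P
gate c0 c1 = P
gate P  P  = P
gate c0 P  = F0
gate P  c0 = F0
gate P  F0 = F0
gate F0 P  = F0
gate F0 c0 = F0
gate c0 F0 = F0
gate F0 F0 = F0
gate c1 P  = F1
gate P  c1 = F1
gate F0 c1 = F1
gate c1 F0 = F1

toΣ : Bool → Σ
toΣ false = c0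
toΣ true  = c1

evalTree : (h : ℕ) → (ℕ → Σ) → (off : ℕ) → Σ
evalTree zero    x off = x off
evalTree (suc h) x off = gate (evalTree h x off) (evalTree h x (off + 2 ^ h))

-- Extend an assignment on Fin n to ℕ (out-of-range positions are never used
-- by the formula of height h when n = 2^h; they get value 0).
extend : {n : ℕ} → (Fin n → Bool) → ℕ → Bool
extend {n} a j with j <? n
... | yes j<n = a (fromℕ< j<n)
... | no  _   = false

formula : (h : ℕ) → (Fin (2 ^ h) → Bool) → Σ
formula h a = evalTree h (λ j → toΣ (extend a j)) 0

Accepted : Σ → Set
Accepted F1 = ⊥
Accepted c1 = ⊥
Accepted _  = ⊤

accepts : (h : ℕ) → (Fin (2 ^ h) → Bool) → Set
accepts h a = Accepted (formula h a)

countOnes : (ℕ → Bool) → (lo len : ℕ) → ℕ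
countOnes x lo zero = 0
countOnes x lo (suc len) with x lo
... | true  = suc (countOnes x (suc lo) len)
... | false = countOnes x (suc lo) len

module Submission where

-- Attach to every gate value v a condition `Counts s v c` on the
-- number c of ones among the s leaves below it: 0 means no ones, 1 means all
-- ones, P means exactly half, F₀ means strictly between none and half, and F₁
-- imposes nothing.  The gate preserves this invariant when two blocks of equal
-- size are combined (`gate-counts`), so by induction every subtree of height k
-- satisfies it with s = 2^k (`evalTree-counts`).  A block with strictly more
-- than half but not all ones is therefore compatible only with F₁
-- (`more-than-half-is-F1`).  Finally F₁ is absorbing for the gate: a formula of
-- height d + k is a formula of height d over its height-k blocks
-- (`evalTree-blocks`), and a single F₁ among the inputs forces the root to F₁
-- (`F1-absorbs`), so the whole formula evaluates to F₁ and rejects.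

open import Defs
open import Data.Nat using (ℕ; zero; suc; _+_; _*_; _^_; _<_; _≤_; _∸_; _<?_; z≤n; s≤s)
open import Data.Nat.Properties
open import Algebra.Properties.CommutativeSemigroup +-commutativeSemigroup using (interchange)
open import Data.Fin using (Fin)
open import Data.Bool using (Bool; true; false)
open import Data.Product using (_×_; _,_)
open import Data.Empty using (⊥-elim)
open import Data.Unit using (⊤; tt)
open import Relation.Nullary using (¬_; yes; no)
open import Relation.Binary.PropositionalEquality

2^suc : ∀ n → 2 ^ suc n ≡ 2 ^ n + 2 ^ n
2^suc n = cong (2 ^ n +_) (+-identityʳ (2 ^ n))

Counts : ℕ → Defs.Σ → ℕ → Set
Counts s c0 c = c ≡ 0
Counts s F0 c = 0 < c × c + c < s
Counts s P  c = c + c ≡ s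
Counts s F1 c = ⊤
Counts s c1 c = c ≡ s

half-pos : ∀ {a s} → 0 < s → a + a ≡ s → 0 < a
half-pos {suc a} _ _ = s≤s z≤n
half-pos {zero} () refl

double-+ : ∀ a b → (a + b) + (a + b) ≡ (a + a) + (b + b)
double-+ a b = interchange a b a b

gate-counts : ∀ {s} vl vr {a b} → 0 < s → Counts s vl a → Counts s vr b
  → Counts (s + s) (gate vl vr) (a + b)
gate-counts c0 c0 _ refl refl = refl
gate-counts {s} c0 F0 s>0 refl (b>0 , 2b<s) = b>0 , <-trans 2b<s (m<m+n s s>0)
gate-counts {s} c0 P  s>0 refl 2b≡s = half-pos s>0 2b≡s , subst (_< s + s) (sym 2b≡s) (m<m+n s s>0)
gate-counts c0 F1 _ _ _ = tt
gate-counts c1 c0 {a} _ refl refl = cong₂ _+_ (+-identityʳ a) (+-identityʳ a)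
gate-counts c0 c1 _ refl refl = refl
gate-counts {s} F0 c0 {a} s>0 (a>0 , 2a<s) refl rewrite +-identityʳ a = a>0 , <-trans 2a<s (m<m+n s s>0)
gate-counts {s} F0 F0 {a} {b} _ (a>0 , 2a<s) (_ , 2b<s) =
  <-≤-trans a>0 (m≤m+n a b) , subst (_< s + s) (sym (double-+ a b)) (+-mono-< 2a<s 2b<s)
gate-counts {s} F0 P {a} {b} _ (a>0 , 2a<s) 2b≡s =
  <-≤-trans a>0 (m≤m+n a b) , subst (_< s + s) (sym (double-+ a b)) (+-mono-<-≤ 2a<s (≤-reflexive 2b≡s))
gate-counts F0 F1 _ _ _ = tt
gate-counts F0 c1 _ _ _ = tt
gate-counts {s} P c0 {a} s>0 2a≡s refl rewrite +-identityʳ a =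
  half-pos s>0 2a≡s , subst (_< s + s) (sym 2a≡s) (m<m+n s s>0)
gate-counts {s} P F0 {a} {b} _ 2a≡s (b>0 , 2b<s) =
  <-≤-trans b>0 (m≤n+m b a) , subst (_< s + s) (sym (double-+ a b)) (+-mono-≤-< (≤-reflexive 2a≡s) 2b<s)
gate-counts P P {a} {b} _ 2a≡s 2b≡s = trans (double-+ a b) (cong₂ _+_ 2a≡s 2b≡s)
gate-counts P F1 _ _ _ = tt
gate-counts P c1 _ _ _ = tt
gate-counts F1 _ _ _ _ = tt
gate-counts c1 F0 _ _ _ = tt
gate-counts c1 P  _ _ _ = tt
gate-counts c1 F1 _ _ _ = tt
gate-counts c1 c1 _ refl refl = refl

countOnes-++ : ∀ (y : ℕ → Bool) lo m n
  → countOnes y lo (m + n) ≡ countOnes y lo m + countOnes y (lo + m) n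
countOnes-++ y lo zero n rewrite +-identityʳ lo = refl
countOnes-++ y lo (suc m) n with y lo
... | true  rewrite +-suc lo m = cong suc (countOnes-++ y (suc lo) m n)
... | false rewrite +-suc lo m = countOnes-++ y (suc lo) m n

evalTree-counts : ∀ (y : ℕ → Bool) k off
  → Counts (2 ^ k) (evalTree k (λ j → toΣ (y j)) off) (countOnes y off (2 ^ k))
evalTree-counts y zero off with y off
... | true  = refl
... | false = refl
evalTree-counts y (suc k) off
  rewrite 2^suc k | countOnes-++ y off (2 ^ k) (2 ^ k) =
  gate-counts (evalTree k x off) (evalTree k x (off + 2 ^ k)) (m^n>0 2 k)
    (evalTree-counts y k off) (evalTree-counts y k (off + 2 ^ k))
  where
  x : ℕ → Defs.Σ
  x j = toΣ (y j)

more-than-half-is-F1 : ∀ {m} v {c} → Counts (m + m) v c → m < c → c < m + m → v ≡ F1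
more-than-half-is-F1 c0 refl () _
more-than-half-is-F1 F0 (_ , 2c<2m) m<c _ = ⊥-elim (<-asym 2c<2m (+-mono-< m<c m<c))
more-than-half-is-F1 P  2c≡2m m<c _ = ⊥-elim (<-irrefl (sym 2c≡2m) (+-mono-< m<c m<c))
more-than-half-is-F1 F1 _ _ _ = refl
more-than-half-is-F1 c1 refl _ c<c = ⊥-elim (<-irrefl refl c<c)

-- F₁ is absorbing on the right (absorption on the left holds by definition).
gate-F1ʳ : ∀ v → gate v F1 ≡ F1
gate-F1ʳ c0 = refl
gate-F1ʳ F0 = refl
gate-F1ʳ P  = refl
gate-F1ʳ F1 = refl
gate-F1ʳ c1 = refl

evalTree-blocks : ∀ (x : ℕ → Defs.Σ) d k o
  → evalTree (d + k) x (o * 2 ^ k) ≡ evalTree d (λ j → evalTree k x (j * 2 ^ k)) o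
evalTree-blocks x zero k o = refl
evalTree-blocks x (suc d) k o =
  cong₂ gate (evalTree-blocks x d k o)
    (trans (cong (evalTree (d + k) x) right-offset) (evalTree-blocks x d k (o + 2 ^ d)))
  where
  right-offset : o * 2 ^ k + 2 ^ (d + k) ≡ (o + 2 ^ d) * 2 ^ k
  right-offset = begin
      o * 2 ^ k + 2 ^ (d + k)    ≡⟨ cong (o * 2 ^ k +_) (^-distribˡ-+-* 2 d k) ⟩
      o * 2 ^ k + 2 ^ d * 2 ^ k  ≡⟨ sym (*-distribʳ-+ (2 ^ k) o (2 ^ d)) ⟩
      (o + 2 ^ d) * 2 ^ k        ∎
    where open ≡-Reasoning

F1-absorbs : ∀ (y : ℕ → Defs.Σ) d off j → j < 2 ^ d → y (off + j) ≡ F1 → evalTree d y off ≡ F1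
F1-absorbs y zero off zero _ yj≡F1 = subst (λ i → y i ≡ F1) (+-identityʳ off) yj≡F1
F1-absorbs y zero off (suc j) (s≤s ()) _
F1-absorbs y (suc d) off j j<2^d+1 yj≡F1 with j <? 2 ^ d
... | yes j<2^d = cong (λ v → gate v (evalTree d y (off + 2 ^ d))) (F1-absorbs y d off j j<2^d yj≡F1)
... | no  j≮2^d =
  trans (cong (gate (evalTree d y off)) (F1-absorbs y d (off + 2 ^ d) (j ∸ 2 ^ d) j'<2^d yj'≡F1)) (gate-F1ʳ (evalTree d y off))
  where
  2^d+j'≡j : 2 ^ d + (j ∸ 2 ^ d) ≡ j
  2^d+j'≡j = m+[n∸m]≡n (≮⇒≥ j≮2^d)
  j'<2^d : j ∸ 2 ^ d < 2 ^ d
  j'<2^d = +-cancelˡ-< (2 ^ d) _ _ (subst₂ _<_ (sym 2^d+j'≡j) (2^suc d) j<2^d+1)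
  yj'≡F1 : y (off + 2 ^ d + (j ∸ 2 ^ d)) ≡ F1
  yj'≡F1 = subst (λ i → y i ≡ F1) (trans (cong (off +_) (sym 2^d+j'≡j)) (sym (+-assoc off _ _))) yj≡F1

F1-rejected : ∀ v → v ≡ F1 → ¬ Accepted v
F1-rejected .F1 refl ()

lemma7p12 : (h : ℕ) → (a : Fin (2 ^ h) → Bool) → (k i : ℕ) → 0 < k → k ≤ h → i < 2 ^ (h ∸ k)
    → 2 ^ (k ∸ 1) < countOnes (extend a) (i * 2 ^ k) (2 ^ k)
    → countOnes (extend a) (i * 2 ^ k) (2 ^ k) < 2 ^ k
    → ¬ accepts h a
lemma7p12 h a zero i () _ _ _ _
lemma7p12 h a (suc k) i _ k≤h i<blocks more-than-half not-all =
  F1-rejected (formula h a) root-F1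
  where
  x : ℕ → Defs.Σ
  x j = toΣ (extend a j)
  ones : ℕ
  ones = countOnes (extend a) (i * 2 ^ suc k) (2 ^ suc k)
  block : ℕ → Defs.Σ
  block j = evalTree (suc k) x (j * 2 ^ suc k)
  block-F1 : block i ≡ F1
  block-F1 = more-than-half-is-F1 (block i)
    (subst (λ s → Counts s (block i) ones) (2^suc k) (evalTree-counts (extend a) (suc k) (i * 2 ^ suc k)))
    more-than-half (subst (ones <_) (2^suc k) not-all)
  root-F1 : evalTree h x 0 ≡ F1
  root-F1 = begin
      evalTree h x 0                                  ≡⟨ cong (λ d → evalTree d x 0) (sym (m∸n+n≡m k≤h)) ⟩
      evalTree (h ∸ suc k + suc k) x (0 * 2 ^ suc k)  ≡⟨ evalTree-blocks x (h ∸ suc k) (suc k) 0 ⟩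
      evalTree (h ∸ suc k) block 0                    ≡⟨ F1-absorbs block (h ∸ suc k) 0 i i<blocks block-F1 ⟩
      F1                                              ∎
    where open ≡-Reasoning
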